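{- Let $T$ be a condensed multi-Catalan tableau of type $X$, and let $c$ be a corner of $T$ that contains a $\beta$. Then the result of the transition of $T$ at $c$ (corner transition, case where the corner contains $\beta$) is a valid condensed multi-Catalan tableau, whose type is the word obtained from $X$ by swapping the two letters associated with $c$ (i.e. $X'\mathrm{DE}X''\mapsto X'\mathrm{ED}X''$, $X'\mathrm{DA}X''\mapsto X'\mathrm{AD}X''$, or $X'\mathrm{AE}X''\mapsto X'\mathrm{EA}X''$).
   Context: Condensed multi-Catalan tableaux. Let $X\in\{\mathrm D,\mathrm E,\mathrm A\}^n$ have $k$ letters $\mathrm D$ and $r$ letters $\mathrm A$. Starting at the north-east corner of a rectangle with $k+r$ rows and $n-k$ columns, draw the lattice path $L(X)$ by reading $X$ left to right: $\mathrm D$ gives a south step, $\mathrm E$ a west step, $\mathrm A$ a west step followed by a south step. Let $Y(X)$ be the Young diagram (rows left-justified and top-justified in the rectangle) whose south-east boundary is $L(X)$: its $i$-th row (from the top) has length $\lambda_i$ = number of west steps of $L(X)$ after its $i$-th south step. Each row corresponds to a south step (its east edge) and each column to a west step (its bottom edge). A row is a D-row or A-row according as its south step comes from a $\mathrm D$ or an $\mathrm A$; a column is an E-column or A-column according as its west step comes from an $\mathrm E$ or an $\mathrm A$. A DE box is a box in a D-row and E-column, and similarly DA, AE, AA boxes. A condensed multi-Catalan tableau of type $X$ is a filling of the boxes of $Y(X)$, each box being empty or containing $\alpha$ or $\beta$, such that: every box having a $\beta$ somewhere to its right in its row, or an $\alpha$ somewhere below it in its column, is empty; every other box contains $\alpha$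 or $\beta$ if it is a DE box, contains $\beta$ if it is a DA box, contains $\alpha$ if it is an AE box, and is empty if it is an AA box. (These are in bijection with the staircase multi-Catalan tableaux of the same type.) A corner of $T$ is a DE, DA or AE box that is both the rightmost box of its row and the bottommost box of its column; corners correspond exactly to the occurrences of consecutive letters $\mathrm{DE}$, $\mathrm{DA}$, $\mathrm{AE}$ in $X$ (a south step immediately followed by a west step), and a corner containing $\alpha$ or $\beta$ always does. Corner transition, case where the corner lies in row $i$ (of length $\lambda_i$) and contains $\beta$: remove row $i$ from $T$; form a new row of length $\lambda_i-1$ whose rightmost box contains $\beta$ and whose other boxes are empty (if $\lambda_i=1$ the new row has length $0$ and contains no $\beta$); insert it among the remaining rows, directly below every remaining row of length $\ge\lambda_i-1$ (so that row lengths stay weakly decreasing from top to bottom; a length-$0$ row goes at the bottom). All other rows keep their contents (boxes counted from the left). Finally the boundary path is labelled by the word obtained from $X$ by swapping the two letters associated to the corner. -}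

module Defs where

open import Data.Nat using (ℕ; zero; suc; _+_; _∸_; _<_; _≤ᵇ_)
open import Data.Bool using (if_then_else_)
open import Data.List using (List; []; _∷_; _++_; length; map; replicate; reverse)
open import Data.Maybe using (Maybe; just; nothing)
open import Data.Product using (_×_; _,_; ∃)
open import Data.Sum using (_⊎_)
open import Data.Empty using (⊥)
open import Relation.Binary.PropositionalEquality using (_≡_)

data Letter : Set where
  D E A : Letter

Word : Set
Word = List Letter

data Cell : Set where
  blank α β : Cell

-- A filling: list of rows (top to bottom), each a list of boxes (left to right).
Filling : Set
Filling = List (List Cell)

at : {S : Set} → List S → ℕ → Maybe S
at []       _       = nothing
at (x ∷ xs) zero    = just x
at (x ∷ xs) (suc n) = at xs n

-- Content of box (i , j) (row i from the top, column j from the left, 0-based),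
-- or nothing if there is no such box.
cellAt : Filling → ℕ → ℕ → Maybe Cell
cellAt T i j with at T i
... | just row = at row j
... | nothing  = nothing

westCount : Word → ℕ
westCount []       = 0
westCount (D ∷ xs) = westCount xs
westCount (E ∷ xs) = suc (westCount xs)
westCount (A ∷ xs) = suc (westCount xs)

southCount : Word → ℕ
southCount []       = 0
southCount (D ∷ xs) = suc (southCount xs)
southCount (E ∷ xs) = southCount xs
southCount (A ∷ xs) = suc (southCount xs)

-- Rows of Y(X), top to bottom: the letter (D or A) producing the south step,
-- and the row length λ_i = number of west steps after that south step.
-- (For A the west step precedes the south step, so it is not counted.)
rowsOf : Word → List (Letter × ℕ)
rowsOf []       = []
rowsOf (D ∷ xs) = (D , westCount xs) ∷ rowsOf xs
rowsOf (E ∷ xs) = rowsOf xs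
rowsOf (A ∷ xs) = (A , westCount xs) ∷ rowsOf xs

rowLengths : Word → List ℕ
rowLengths X = map (λ p → Data.Product.proj₂ p) (rowsOf X)

rowKinds : Word → List Letter
rowKinds X = map (λ p → Data.Product.proj₁ p) (rowsOf X)

westLetters : Word → List Letter
westLetters []       = []
westLetters (D ∷ xs) = westLetters xs
westLetters (E ∷ xs) = E ∷ westLetters xs
westLetters (A ∷ xs) = A ∷ westLetters xs

-- Columns of Y(X), left to right: the path goes westward, so the leftmost
-- column corresponds to the last west step.
colKinds : Word → List Letter
colKinds X = reverse (westLetters X)

Killed : Filling → ℕ → ℕ → Set
Killed T i j = (∃ λ j' → j < j' × cellAt T i j' ≡ just β)
             ⊎ (∃ λ i' → i < i' × cellAt T i' j ≡ just α)

Allowed : Letter → Letter → Cell → Set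
Allowed D E c = c ≡ α ⊎ c ≡ β
Allowed D A c = c ≡ β
Allowed A E c = c ≡ α
Allowed A A c = c ≡ blank
Allowed _ _ c = c ≡ blank   -- never occurs (rows are D/A, columns are E/A)

record IsCMCT (X : Word) (T : Filling) : Set where
  field
    shape  : map length T ≡ rowLengths X
    killed : ∀ i j c → cellAt T i j ≡ just c → Killed T i j → c ≡ blank
    free   : ∀ i j c rk ck → cellAt T i j ≡ just c →
             at (rowKinds X) i ≡ just rk → at (colKinds X) j ≡ just ck →
             (Killed T i j → ⊥) → Allowed rk ck c

data CornerPair : Letter → Letter → Set where
  DE : CornerPair D E
  DA : CornerPair D A
  AE : CornerPair A E

removeRow : Filling → ℕ → Filling
removeRow []       _       = []
removeRow (r ∷ rs) zero    = rs
removeRow (r ∷ rs) (suc i) = r ∷ removeRow rs i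

newRow : ℕ → List Cell
newRow zero    = []
newRow (suc m) = replicate m blank ++ (β ∷ [])

insertBelow : ℕ → List Cell → Filling → Filling
insertBelow m r []       = r ∷ []
insertBelow m r (s ∷ ss) =
  if m ≤ᵇ length s then s ∷ insertBelow m r ss else r ∷ s ∷ ss

rowLength : Filling → ℕ → ℕ
rowLength T i with at T i
... | just r  = length r
... | nothing = 0

transitionβ : Filling → ℕ → Filling
transitionβ T i =
  insertBelow (rowLength T i ∸ 1) (newRow (rowLength T i ∸ 1)) (removeRow T i)

-- A box is killed by boxes of its own row and of the rows below it only, so a filling can be
-- checked row by row, each row against the α's occurring below it.  At a D-corner the β is the
-- last box of its row, so the rest of that row is killed and blank: the corner row carries no α,
-- and neither does the new row.  Hence every row above the corner, which the new row is inserted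
-- below, sees the same α's below it as before.  Below the corner all rows are shorter than the
-- corner row and weakly decreasing, so nothing under the new row reaches the column of its β,
-- which is therefore unkilled and allowed (columns are E or A).  The rows of the new word are
-- those of the old one with the corner row replaced by the new row, since the rows it is
-- inserted after are the D-rows (and, for DA, the A-row) of that same length.  An AE corner
-- never holds β, as β is not allowed in an A-row.

module Submission where

open import Defs
open import Data.List using (_++_; _∷_)
open import Data.Maybe using (just)
open import Relation.Binary.PropositionalEquality using (_≡_)

open import Data.Bool using (true; false; if_then_else_)
open import Data.Empty using (⊥-elim)
open import Data.List using (List; []; length; map; reverse)
open import Data.List.Membership.Propositional using (_∈_; _∉_)
open import Data.List.Properties using (∷-injective; length-map; length-reverse)
open import Data.List.Relation.Unary.All as All using (All; []; _∷_)
open import Data.List.Relation.Unary.All.Properties using (All¬⇒¬Any; map⁺)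
open import Data.List.Relation.Unary.AllPairs using (AllPairs; []; _∷_)
open import Data.List.Relation.Unary.Any using (Any; here; there)
open import Data.List.Relation.Unary.Any.Properties using (reverse⁻)
open import Data.Maybe using (nothing)
open import Data.Nat using (ℕ; zero; suc; _+_; _∸_; _<_; _≤_; _≤ᵇ_; z≤n; s≤s)
open import Data.Nat.Properties
  using ( ≤ᵇ-reflects-≤; ≤-pred; ≰⇒>; <⇒≱; <⇒≤; ≤-<-trans; ≤-refl; ≤-trans; n≤1+n; m≤n+m
        ; m<1+n⇒m<n∨m≡n)
open import Data.Product using (∃; _×_; _,_; proj₁; proj₂; map₂)
open import Data.Sum using (_⊎_; inj₁; inj₂)
open import Function using (_∘_; id)
open import Function.Bundles using (_⇔_; mk⇔; Equivalence)
open import Relation.Binary.PropositionalEquality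
  using (module ≡-Reasoning; refl; sym; trans; cong; cong₂; subst; subst₂; _≢_)
open import Relation.Nullary using (¬_)
open import Relation.Nullary.Reflects using (ofʸ; ofⁿ)

open Equivalence using (to; from)
open ≡-Reasoning

variable
  S : Set
  xs : List S
  x : S
  i j m w : ℕ
  k : Letter
  C : List Letter
  row r : List Cell
  T : Filling
  R RP : List (Letter × ℕ)

at⇒< : (xs : List S) {j : ℕ} → at xs j ≡ just x → j < length xs
at⇒< (_ ∷ _)  {zero}  _ = s≤s z≤n
at⇒< (_ ∷ xs) {suc j} e = s≤s (at⇒< xs e)

at⇒∈ : at xs j ≡ just x → x ∈ xs
at⇒∈ {xs = _ ∷ _} {zero}  refl = here refl
at⇒∈ {xs = _ ∷ xs} {suc j} e    = there (at⇒∈ {xs = xs} e)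

<⇒at : (xs : List S) {j : ℕ} → j < length xs → ∃ λ x → at xs j ≡ just x
<⇒at (x ∷ _)  {zero}  _         = x , refl
<⇒at (_ ∷ xs) {suc j} (s≤s j<n) = <⇒at xs j<n

cellAt-suc : ∀ row T i j → cellAt (row ∷ T) (suc i) j ≡ cellAt T i j
cellAt-suc row T i j with at T i
... | just _  = refl
... | nothing = refl

rowLength-suc : ∀ row T i → rowLength (row ∷ T) (suc i) ≡ rowLength T i
rowLength-suc row T i with at T i
... | just _  = refl
... | nothing = refl

HasαIn : ℕ → Filling → Set
HasαIn j = Any (λ row → at row j ≡ just α)

cellAt⇒HasαIn : cellAt T i j ≡ just α → HasαIn j T
cellAt⇒HasαIn {T = _ ∷ _}   {zero}  e = here e
cellAt⇒HasαIn {T = row ∷ T} {suc i} e = there (cellAt⇒HasαIn (trans (sym (cellAt-suc row T i _)) e))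

HasαIn⇒cellAt : HasαIn j T → ∃ λ i → cellAt T i j ≡ just α
HasαIn⇒cellAt (here e) = zero , e
HasαIn⇒cellAt {T = row ∷ T} (there h) with HasαIn⇒cellAt h
... | i , e = suc i , trans (cellAt-suc row T i _) e

KilledIn : List Cell → Filling → ℕ → Set
KilledIn row below j = (∃ λ j' → j < j' × at row j' ≡ just β) ⊎ HasαIn j below

Killed-zero : Killed (row ∷ T) zero j ⇔ KilledIn row T j
Killed-zero {row} {T} {j} = mk⇔ to′ from′
  where
  to′ : Killed (row ∷ T) zero j → KilledIn row T j
  to′ (inj₁ βright)          = inj₁ βright
  to′ (inj₂ (suc i , _ , e)) = inj₂ (cellAt⇒HasαIn (trans (sym (cellAt-suc row T i j)) e))
  from′ : KilledIn row T j → Killed (row ∷ T) zero j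
  from′ (inj₁ βright) = inj₁ βright
  from′ (inj₂ h) with HasαIn⇒cellAt h
  ... | i , e = inj₂ (suc i , s≤s z≤n , trans (cellAt-suc row T i j) e)

Killed-suc : Killed (row ∷ T) (suc i) j ⇔ Killed T i j
Killed-suc {row} {T} {i} {j} = mk⇔ to′ from′
  where
  to′ : Killed (row ∷ T) (suc i) j → Killed T i j
  to′ (inj₁ (j' , j<j' , e))           = inj₁ (j' , j<j' , trans (sym (cellAt-suc row T i j')) e)
  to′ (inj₂ (suc i' , s≤s i<i' , e)) = inj₂ (i' , i<i' , trans (sym (cellAt-suc row T i' j)) e)
  from′ : Killed T i j → Killed (row ∷ T) (suc i) j
  from′ (inj₁ (j' , j<j' , e)) = inj₁ (j' , j<j' , trans (cellAt-suc row T i j') e)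
  from′ (inj₂ (i' , i<i' , e)) = inj₂ (suc i' , s≤s i<i' , trans (cellAt-suc row T i' j) e)

record ValidRow (C : List Letter) (k : Letter) (row : List Cell) (below : Filling) : Set where
  field
    killed : ∀ j c → at row j ≡ just c → KilledIn row below j → c ≡ blank
    free   : ∀ j c ck → at row j ≡ just c → at C j ≡ just ck →
             ¬ KilledIn row below j → Allowed k ck c

data ValidRows (C : List Letter) : Filling → List (Letter × ℕ) → Set where
  []     : ValidRows C [] []
  valid∷ : ∀ {l} → length row ≡ l → ValidRow C k row T → ValidRows C T R →
           ValidRows C (row ∷ T) ((k , l) ∷ R)

record IsTableau (C : List Letter) (R : List (Letter × ℕ)) (T : Filling) : Set where
  field
    shape  : map length T ≡ map proj₂ R
    killed : ∀ i j c → cellAt T i j ≡ just c → Killed T i j → c ≡ blank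
    free   : ∀ i j c rk ck → cellAt T i j ≡ just c → at (map proj₁ R) i ≡ just rk →
             at C j ≡ just ck → ¬ Killed T i j → Allowed rk ck c

validRows⇒isTableau : ValidRows C T R → IsTableau C R T
validRows⇒isTableau [] = record { shape = refl ; killed = λ _ _ _ () ; free = λ _ _ _ _ _ () }
validRows⇒isTableau {C} {row ∷ T} {(k , l) ∷ R} (valid∷ len ρ v) = record
  { shape = cong₂ _∷_ len (IsTableau.shape below) ; killed = killed ; free = free }
  where
  below : IsTableau C R T
  below = validRows⇒isTableau v
  killed : ∀ i j c → cellAt (row ∷ T) i j ≡ just c → Killed (row ∷ T) i j → c ≡ blank
  killed zero    j c e κ = ValidRow.killed ρ j c e (to Killed-zero κ)
  killed (suc i) j c e κ =
    IsTableau.killed below i j c (trans (sym (cellAt-suc row T i j)) e) (to Killed-suc κ)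
  free : ∀ i j c rk ck → cellAt (row ∷ T) i j ≡ just c → at (k ∷ map proj₁ R) i ≡ just rk →
         at C j ≡ just ck → ¬ Killed (row ∷ T) i j → Allowed rk ck c
  free zero    j c _  ck e refl ec ¬κ = ValidRow.free ρ j c ck e ec (¬κ ∘ from Killed-zero)
  free (suc i) j c rk ck e er ec ¬κ =
    IsTableau.free below i j c rk ck (trans (sym (cellAt-suc row T i j)) e) er ec
                   (¬κ ∘ from Killed-suc)

isTableau⇒validRows : IsTableau C R T → ValidRows C T R
isTableau⇒validRows {R = []}    {T = []}    _ = []
isTableau⇒validRows {R = _ ∷ _} {T = []}    t with IsTableau.shape t
... | ()
isTableau⇒validRows {R = []}    {T = _ ∷ _} t with IsTableau.shape t
... | ()
isTableau⇒validRows {C} {(k , l) ∷ R} {row ∷ T} t =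
  valid∷ (proj₁ (∷-injective (IsTableau.shape t))) headRow (isTableau⇒validRows tail)
  where
  headRow : ValidRow C k row T
  headRow = record
    { killed = λ j c e κ → IsTableau.killed t zero j c e (from Killed-zero κ)
    ; free   = λ j c ck e ec ¬κ → IsTableau.free t zero j c k ck e refl ec (¬κ ∘ to Killed-zero) }
  tail : IsTableau C R T
  tail = record
    { shape  = proj₂ (∷-injective (IsTableau.shape t))
    ; killed = λ i j c e κ →
        IsTableau.killed t (suc i) j c (trans (cellAt-suc row T i j) e) (from Killed-suc κ)
    ; free   = λ i j c rk ck e er ec ¬κ →
        IsTableau.free t (suc i) j c rk ck (trans (cellAt-suc row T i j) e) er ec
                       (¬κ ∘ to Killed-suc) }

isCMCT⇒validRows : ∀ {X} → IsCMCT X T → ValidRows (colKinds X) T (rowsOf X)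
isCMCT⇒validRows t = isTableau⇒validRows record
  { shape = IsCMCT.shape t ; killed = IsCMCT.killed t ; free = IsCMCT.free t }

validRows⇒isCMCT : ∀ {X} → ValidRows (colKinds X) T (rowsOf X) → IsCMCT X T
validRows⇒isCMCT v = record { shape = shape ; killed = killed ; free = free }
  where open IsTableau (validRows⇒isTableau v)

αFree : List Cell → Set
αFree row = ∀ j → at row j ≢ just α

infix 4 _≈α_
_≈α_ : Filling → Filling → Set
T ≈α T' = ∀ j → HasαIn j T ⇔ HasαIn j T'

≈α-refl : T ≈α T
≈α-refl _ = mk⇔ id id

≈α-sym : ∀ {T'} → T ≈α T' → T' ≈α T
≈α-sym eq j = mk⇔ (from (eq j)) (to (eq j))

≈α-trans : ∀ {T' T''} → T ≈α T' → T' ≈α T'' → T ≈α T''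
≈α-trans eq eq' j = mk⇔ (to (eq' j) ∘ to (eq j)) (from (eq j) ∘ from (eq' j))

∷-cong-≈α : ∀ {T'} → T ≈α T' → row ∷ T ≈α row ∷ T'
∷-cong-≈α eq j = mk⇔ (step (to (eq j))) (step (from (eq j)))
  where
  step : ∀ {U U'} → (HasαIn j U → HasαIn j U') → HasαIn j (_ ∷ U) → HasαIn j (_ ∷ U')
  step f (here e)  = here e
  step f (there h) = there (f h)

αFree-∷-≈α : αFree row → row ∷ T ≈α T
αFree-∷-≈α free j = mk⇔ drop there
  where
  drop : HasαIn j (_ ∷ _) → HasαIn j _
  drop (here e)  = ⊥-elim (free j e)
  drop (there h) = h

removeRow-≈α : (∀ j → cellAt T i j ≢ just α) → T ≈α removeRow T i
removeRow-≈α {T = []}              _    = ≈α-refl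
removeRow-≈α {T = row ∷ T} {zero}  free = αFree-∷-≈α free
removeRow-≈α {T = row ∷ T} {suc i} free =
  ∷-cong-≈α (removeRow-≈α (λ j → free j ∘ trans (cellAt-suc row T i j)))

insertBelow-≈α : αFree r → T ≈α insertBelow m r T
insertBelow-≈α {T = []}      free = ≈α-sym (αFree-∷-≈α free)
insertBelow-≈α {T = row ∷ T} {m = m} free with m ≤ᵇ length row
... | true  = ∷-cong-≈α (insertBelow-≈α free)
... | false = ≈α-sym (αFree-∷-≈α free)

ValidRow-≈α : ∀ {T'} → T ≈α T' → ValidRow C k row T → ValidRow C k row T'
ValidRow-≈α {row = row} eq ρ = record
  { killed = λ j c e κ → ValidRow.killed ρ j c e (along (from (eq j)) κ)
  ; free   = λ j c ck e ec ¬κ → ValidRow.free ρ j c ck e ec (¬κ ∘ along (to (eq j))) }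
  where
  along : ∀ {U U'} → (HasαIn j U → HasαIn j U') → KilledIn row U j → KilledIn row U' j
  along f (inj₁ βright) = inj₁ βright
  along f (inj₂ h)      = inj₂ (f h)

length-newRow : ∀ m → length (newRow m) ≡ m
length-newRow zero          = refl
length-newRow (suc zero)    = refl
length-newRow (suc (suc m)) = cong suc (length-newRow (suc m))

at-newRow : ∀ m {j c} → at (newRow (suc m)) j ≡ just c → (j < m × c ≡ blank) ⊎ (j ≡ m × c ≡ β)
at-newRow zero    {zero}  refl = inj₂ (refl , refl)
at-newRow (suc m) {zero}  refl = inj₁ (s≤s z≤n , refl)
at-newRow (suc m) {suc j} e with at-newRow m e
... | inj₁ (j<m , c≡blank) = inj₁ (s≤s j<m , c≡blank)
... | inj₂ (refl , c≡β)    = inj₂ (refl , c≡β)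

at-newRow-last : ∀ m → at (newRow (suc m)) m ≡ just β
at-newRow-last zero    = refl
at-newRow-last (suc m) = at-newRow-last m

newRow-αFree : ∀ m → αFree (newRow m)
newRow-αFree (suc m) j e with at-newRow m e
... | inj₁ (_ , ())
... | inj₂ (_ , ())

shortRows-¬HasαIn : All (λ s → length s ≤ j) T → ¬ HasαIn j T
shortRows-¬HasαIn short = All¬⇒¬Any (All.map (λ {s} s≤j e → <⇒≱ (at⇒< s e) s≤j) short)

Allowed-Dβ : ∀ {ck} → ck ∈ C → D ∉ C → Allowed D ck β
Allowed-Dβ {ck = D} ck∈C D∉C = ⊥-elim (D∉C ck∈C)
Allowed-Dβ {ck = E} _    _   = inj₂ refl
Allowed-Dβ {ck = A} _    _   = refl

newRow-valid : ∀ m → D ∉ C → All (λ s → length s < m) T → ValidRow C D (newRow m) T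
newRow-valid zero _ _ = record { killed = λ _ _ () ; free = λ _ _ _ () }
newRow-valid {C} {T} (suc m) D∉C short = record { killed = killed ; free = free }
  where
  βUnkilled : ¬ KilledIn (newRow (suc m)) T m
  βUnkilled (inj₁ (j' , m<j' , e)) =
    <⇒≱ m<j' (≤-pred (subst (j' <_) (length-newRow (suc m)) (at⇒< (newRow (suc m)) e)))
  βUnkilled (inj₂ h) = shortRows-¬HasαIn (All.map (λ { (s≤s s≤m) → s≤m }) short) h
  killed : ∀ j c → at (newRow (suc m)) j ≡ just c → KilledIn (newRow (suc m)) T j → c ≡ blank
  killed j c e κ with at-newRow m e
  ... | inj₁ (_ , c≡blank) = c≡blank
  ... | inj₂ (refl , _)    = ⊥-elim (βUnkilled κ)
  free : ∀ j c ck → at (newRow (suc m)) j ≡ just c → at C j ≡ just ck →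
         ¬ KilledIn (newRow (suc m)) T j → Allowed D ck c
  free j c ck e ec ¬κ with at-newRow m e
  ... | inj₁ (j<m , _)  = ⊥-elim (¬κ (inj₁ (m , j<m , at-newRow-last m)))
  ... | inj₂ (_ , refl) = Allowed-Dβ (at⇒∈ ec) D∉C

insertRowBelow : ℕ → Letter × ℕ → List (Letter × ℕ) → List (Letter × ℕ)
insertRowBelow m p []       = p ∷ []
insertRowBelow m p (q ∷ qs) = if m ≤ᵇ proj₂ q then q ∷ insertRowBelow m p qs else p ∷ q ∷ qs

Descending : List (Letter × ℕ) → Set
Descending = AllPairs (λ p q → proj₂ q ≤ proj₂ p)

validRows-lengths : ∀ {P : ℕ → Set} → ValidRows C T R → All (P ∘ proj₂) R → All (P ∘ length) T
validRows-lengths []                  []       = []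
validRows-lengths (valid∷ refl _ v) (p ∷ ps) = p ∷ validRows-lengths v ps

insertNewRow-valid : D ∉ C → Descending R → ValidRows C T R →
                     ValidRows C (insertBelow m (newRow m) T) (insertRowBelow m (D , m) R)
insertNewRow-valid {m = m} D∉C [] [] = valid∷ (length-newRow m) (newRow-valid m D∉C []) []
insertNewRow-valid {m = m} D∉C (shorter ∷ desc) (valid∷ {row = s} {T = rest} refl ρ v)
  with m ≤ᵇ length s | ≤ᵇ-reflects-≤ m (length s)
... | true  | _ = valid∷ refl (ValidRow-≈α (insertBelow-≈α (newRow-αFree m)) ρ)
                           (insertNewRow-valid D∉C desc v)
... | false | ofⁿ m≰s =
  valid∷ (length-newRow m) (newRow-valid m D∉C (s<m ∷ rest<m)) (valid∷ refl ρ v)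
  where
  s<m : length s < m
  s<m = ≰⇒> m≰s
  rest<m : All (λ t → length t < m) rest
  rest<m = validRows-lengths v (All.map (λ t≤s → ≤-<-trans t≤s s<m) shorter)

lastβ-αFree : ValidRow C k row T → length row ≡ suc w → at row w ≡ just β → αFree row
lastβ-αFree {row = row} {w = w} ρ len eβ j eα
  with m<1+n⇒m<n∨m≡n (subst (j <_) len (at⇒< row eα))
... | inj₁ j<w with ValidRow.killed ρ j α eα (inj₁ (w , j<w , eβ))
...   | ()
lastβ-αFree ρ len eβ j eα | inj₂ refl with trans (sym eα) eβ
... | ()

cornerRow-αFree : ValidRows C T (RP ++ (k , suc w) ∷ R) → cellAt T (length RP) w ≡ just β →
                  ∀ j → cellAt T (length RP) j ≢ just α
cornerRow-αFree {RP = []}    (valid∷ len ρ _) eβ = lastβ-αFree ρ len eβ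
cornerRow-αFree {T = row ∷ T} {RP = _ ∷ RP} {w = w} (valid∷ _ _ v) eβ j =
  cornerRow-αFree v (trans (sym (cellAt-suc row T (length RP) w)) eβ) j
  ∘ trans (cellAt-suc row T (length RP) j)

cornerRow-length : ValidRows C T (RP ++ (k , w) ∷ R) → rowLength T (length RP) ≡ w
cornerRow-length {RP = []}                   (valid∷ len _ _) = len
cornerRow-length {T = row ∷ T} {RP = _ ∷ RP} (valid∷ _ _ v)   =
  trans (rowLength-suc row T (length RP)) (cornerRow-length v)

moveRow : ℕ → ℕ → Filling → Filling
moveRow m i T = insertBelow m (newRow m) (removeRow T i)

moveRow-≈α : (∀ j → cellAt T i j ≢ just α) → T ≈α moveRow m i T
moveRow-≈α {m = m} free = ≈α-trans (removeRow-≈α free) (insertBelow-≈α (newRow-αFree m))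

insertBelow-skip : ∀ r → m ≤ length row → insertBelow m r (row ∷ T) ≡ row ∷ insertBelow m r T
insertBelow-skip {m} {row} r m≤row with m ≤ᵇ length row | ≤ᵇ-reflects-≤ m (length row)
... | true  | _       = refl
... | false | ofⁿ m≰row = ⊥-elim (m≰row m≤row)

moveRow-valid : D ∉ C → Descending R → All (λ p → suc w ≤ proj₂ p) RP →
                ValidRows C T (RP ++ (D , suc w) ∷ R) → cellAt T (length RP) w ≡ just β →
                ValidRows C (moveRow w (length RP) T) (RP ++ insertRowBelow w (D , w) R)
moveRow-valid {RP = []} D∉C desc [] (valid∷ _ _ v) _ = insertNewRow-valid D∉C desc v
moveRow-valid {w = w} {RP = _ ∷ RP} {T = row ∷ T}
              D∉C desc (w<row ∷ above) (valid∷ refl ρ v) eβ =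
  subst (λ T' → ValidRows _ T' _) (sym (insertBelow-skip (newRow w) (<⇒≤ w<row)))
    (valid∷ refl (ValidRow-≈α (moveRow-≈α (cornerRow-αFree v eβ′)) ρ)
                 (moveRow-valid D∉C desc above v eβ′))
  where
  eβ′ : cellAt T (length RP) w ≡ just β
  eβ′ = trans (sym (cellAt-suc row T (length RP) w)) eβ

westCount-++ : ∀ X Y → westCount (X ++ Y) ≡ westCount X + westCount Y
westCount-++ []      Y = refl
westCount-++ (D ∷ X) Y = westCount-++ X Y
westCount-++ (E ∷ X) Y = cong suc (westCount-++ X Y)
westCount-++ (A ∷ X) Y = cong suc (westCount-++ X Y)

westLetters-++ : ∀ X Y → westLetters (X ++ Y) ≡ westLetters X ++ westLetters Y
westLetters-++ []      Y = refl
westLetters-++ (D ∷ X) Y = westLetters-++ X Y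
westLetters-++ (E ∷ X) Y = cong (E ∷_) (westLetters-++ X Y)
westLetters-++ (A ∷ X) Y = cong (A ∷_) (westLetters-++ X Y)

lengthenRows : ℕ → List (Letter × ℕ) → List (Letter × ℕ)
lengthenRows m = map (map₂ (_+ m))

rowsOf-++ : ∀ X Y → rowsOf (X ++ Y) ≡ lengthenRows (westCount Y) (rowsOf X) ++ rowsOf Y
rowsOf-++ []      Y = refl
rowsOf-++ (D ∷ X) Y = cong₂ _∷_ (cong (D ,_) (westCount-++ X Y)) (rowsOf-++ X Y)
rowsOf-++ (E ∷ X) Y = rowsOf-++ X Y
rowsOf-++ (A ∷ X) Y = cong₂ _∷_ (cong (A ,_) (westCount-++ X Y)) (rowsOf-++ X Y)

lengthenRows-≥ : ∀ m R → All (λ p → m ≤ proj₂ p) (lengthenRows m R)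
lengthenRows-≥ m R = map⁺ (All.universal (λ p → m≤n+m m (proj₂ p)) R)

southCount≡length-rowsOf : ∀ X → southCount X ≡ length (rowsOf X)
southCount≡length-rowsOf []      = refl
southCount≡length-rowsOf (D ∷ X) = cong suc (southCount≡length-rowsOf X)
southCount≡length-rowsOf (E ∷ X) = southCount≡length-rowsOf X
southCount≡length-rowsOf (A ∷ X) = cong suc (southCount≡length-rowsOf X)

rowsOf-≤-westCount : ∀ X → All (λ p → proj₂ p ≤ westCount X) (rowsOf X)
rowsOf-≤-westCount []      = []
rowsOf-≤-westCount (D ∷ X) = ≤-refl ∷ rowsOf-≤-westCount X
rowsOf-≤-westCount (E ∷ X) = All.map (λ p≤ → ≤-trans p≤ (n≤1+n _)) (rowsOf-≤-westCount X)
rowsOf-≤-westCount (A ∷ X) = n≤1+n _ ∷ All.map (λ p≤ → ≤-trans p≤ (n≤1+n _)) (rowsOf-≤-westCount X)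

rowsOf-descending : ∀ X → Descending (rowsOf X)
rowsOf-descending []      = []
rowsOf-descending (D ∷ X) = rowsOf-≤-westCount X ∷ rowsOf-descending X
rowsOf-descending (E ∷ X) = rowsOf-descending X
rowsOf-descending (A ∷ X) = rowsOf-≤-westCount X ∷ rowsOf-descending X

insertRowBelow-skip : ∀ p {k l} → m ≤ l →
                      insertRowBelow m p ((k , l) ∷ R) ≡ (k , l) ∷ insertRowBelow m p R
insertRowBelow-skip {m} p {l = l} m≤l with m ≤ᵇ l | ≤ᵇ-reflects-≤ m l
... | true  | _       = refl
... | false | ofⁿ m≰l = ⊥-elim (m≰l m≤l)

insertRowBelow-front : ∀ p → All (λ q → proj₂ q < m) R → insertRowBelow m p R ≡ p ∷ R
insertRowBelow-front p [] = refl
insertRowBelow-front {m} p (_∷_ {x = _ , l} l<m _) with m ≤ᵇ l | ≤ᵇ-reflects-≤ m l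
... | true  | ofʸ m≤l = ⊥-elim (<⇒≱ l<m m≤l)
... | false | _       = refl

-- The rows of X of full length westCount X are the D-rows of its leading D's.
insertRowBelow-rowsOf : ∀ X → insertRowBelow (westCount X) (D , westCount X) (rowsOf X)
                              ≡ (D , westCount X) ∷ rowsOf X
insertRowBelow-rowsOf []      = refl
insertRowBelow-rowsOf (D ∷ X) =
  trans (insertRowBelow-skip _ ≤-refl) (cong ((D , westCount X) ∷_) (insertRowBelow-rowsOf X))
insertRowBelow-rowsOf (E ∷ X) = insertRowBelow-front _ (All.map s≤s (rowsOf-≤-westCount X))
insertRowBelow-rowsOf (A ∷ X) = insertRowBelow-front _ (≤-refl ∷ All.map s≤s (rowsOf-≤-westCount X))

D∉westLetters : ∀ X → D ∉ westLetters X
D∉westLetters (D ∷ X) D∈       = D∉westLetters X D∈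
D∉westLetters (E ∷ X) (there D∈) = D∉westLetters X D∈
D∉westLetters (A ∷ X) (there D∈) = D∉westLetters X D∈

D∉colKinds : ∀ X → D ∉ colKinds X
D∉colKinds X = D∉westLetters X ∘ reverse⁻

length-colKinds : ∀ X → length (colKinds X) ≡ westCount X
length-colKinds X = trans (length-reverse (westLetters X)) (length-westLetters X)
  where
  length-westLetters : ∀ X → length (westLetters X) ≡ westCount X
  length-westLetters []      = refl
  length-westLetters (D ∷ X) = length-westLetters X
  length-westLetters (E ∷ X) = cong suc (length-westLetters X)
  length-westLetters (A ∷ X) = cong suc (length-westLetters X)

rowKinds-southCount : ∀ X' Y → at (rowKinds (X' ++ A ∷ Y)) (southCount X') ≡ just A
rowKinds-southCount []       Y = refl
rowKinds-southCount (D ∷ X') Y = rowKinds-southCount X' Y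
rowKinds-southCount (E ∷ X') Y = rowKinds-southCount X' Y
rowKinds-southCount (A ∷ X') Y = rowKinds-southCount X' Y

β∉A-row : ∀ {X} → IsCMCT X T → at (rowKinds X) i ≡ just A → j < westCount X →
          cellAt T i j ≢ just β
β∉A-row {T} {i} {j} {X} t rowA j<w eβ
  with <⇒at (colKinds X) (subst (j <_) (sym (length-colKinds X)) j<w)
... | ck , colk = noβ ck (IsCMCT.free t i j β A ck eβ rowA colk unkilled)
  where
  unkilled : ¬ Killed T i j
  unkilled κ with IsCMCT.killed t i j β eβ κ
  ... | ()
  noβ : ∀ ck → ¬ Allowed A ck β
  noβ D ()
  noβ E ()
  noβ A ()

westCount-corner : ∀ {a b} → CornerPair a b → ∀ Y → westCount (b ∷ Y) ≡ suc (westCount Y)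
westCount-corner DE _ = refl
westCount-corner DA _ = refl
westCount-corner AE _ = refl

westLetters-swapD : ∀ {b} → CornerPair D b → ∀ Y → westLetters (D ∷ b ∷ Y) ≡ westLetters (b ∷ D ∷ Y)
westLetters-swapD DE _ = refl
westLetters-swapD DA _ = refl

rowsOf-swapD : ∀ {b} → CornerPair D b → ∀ Y →
               rowsOf (b ∷ D ∷ Y) ≡ insertRowBelow (westCount Y) (D , westCount Y) (rowsOf (b ∷ Y))
rowsOf-swapD DE Y = sym (insertRowBelow-rowsOf Y)
rowsOf-swapD DA Y =
  sym (trans (insertRowBelow-skip _ ≤-refl) (cong ((A , westCount Y) ∷_) (insertRowBelow-rowsOf Y)))

rowsOf-cornerD : ∀ {b} → CornerPair D b → ∀ X' X'' →
                 rowsOf (X' ++ D ∷ b ∷ X'')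
                 ≡ lengthenRows (suc (westCount X'')) (rowsOf X')
                   ++ (D , suc (westCount X'')) ∷ rowsOf (b ∷ X'')
rowsOf-cornerD {b} p X' X'' = begin
  rowsOf (X' ++ D ∷ b ∷ X'')
    ≡⟨ rowsOf-++ X' (D ∷ b ∷ X'') ⟩
  lengthenRows (westCount (b ∷ X'')) (rowsOf X') ++ (D , westCount (b ∷ X'')) ∷ rowsOf (b ∷ X'')
    ≡⟨ cong (λ n → lengthenRows n (rowsOf X') ++ (D , n) ∷ rowsOf (b ∷ X'')) (westCount-corner p X'') ⟩
  lengthenRows (suc (westCount X'')) (rowsOf X') ++ (D , suc (westCount X'')) ∷ rowsOf (b ∷ X'') ∎

rowsOf-swappedD : ∀ {b} → CornerPair D b → ∀ X' X'' →
                  rowsOf (X' ++ b ∷ D ∷ X'')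
                  ≡ lengthenRows (suc (westCount X'')) (rowsOf X')
                    ++ insertRowBelow (westCount X'') (D , westCount X'') (rowsOf (b ∷ X''))
rowsOf-swappedD {b} p X' X'' = begin
  rowsOf (X' ++ b ∷ D ∷ X'')
    ≡⟨ rowsOf-++ X' (b ∷ D ∷ X'') ⟩
  lengthenRows (westCount (b ∷ D ∷ X'')) (rowsOf X') ++ rowsOf (b ∷ D ∷ X'')
    ≡⟨ cong₂ (λ n R → lengthenRows n (rowsOf X') ++ R) (westCount-corner p (D ∷ X'')) (rowsOf-swapD p X'') ⟩
  lengthenRows (suc (westCount X'')) (rowsOf X')
    ++ insertRowBelow (westCount X'') (D , westCount X'') (rowsOf (b ∷ X'')) ∎

colKinds-swapD : ∀ {b} → CornerPair D b → ∀ X' X'' →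
                 colKinds (X' ++ D ∷ b ∷ X'') ≡ colKinds (X' ++ b ∷ D ∷ X'')
colKinds-swapD {b} p X' X'' = cong reverse (begin
  westLetters (X' ++ D ∷ b ∷ X'')              ≡⟨ westLetters-++ X' (D ∷ b ∷ X'') ⟩
  westLetters X' ++ westLetters (D ∷ b ∷ X'')  ≡⟨ cong (westLetters X' ++_) (westLetters-swapD p X'') ⟩
  westLetters X' ++ westLetters (b ∷ D ∷ X'')  ≡⟨ westLetters-++ X' (b ∷ D ∷ X'') ⟨
  westLetters (X' ++ b ∷ D ∷ X'')              ∎)

transitionβ-cornerD : ∀ {b} X' X'' → CornerPair D b → IsCMCT (X' ++ D ∷ b ∷ X'') T →
                      cellAt T (southCount X') (westCount X'') ≡ just β →
                      IsCMCT (X' ++ b ∷ D ∷ X'') (transitionβ T (southCount X'))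
transitionβ-cornerD {T} {b} X' X'' p t eβ =
  subst (IsCMCT (X' ++ b ∷ D ∷ X'')) (sym transition≡)
    (validRows⇒isCMCT (subst₂ (λ C R → ValidRows C (moveRow n h T) R)
                               (colKinds-swapD p X' X'') (sym (rowsOf-swappedD p X' X'')) after))
  where
  n = westCount X''
  h = length (lengthenRows (suc n) (rowsOf X'))
  h≡ : southCount X' ≡ h
  h≡ = trans (southCount≡length-rowsOf X') (sym (length-map _ (rowsOf X')))
  before : ValidRows (colKinds (X' ++ D ∷ b ∷ X'')) T
                     (lengthenRows (suc n) (rowsOf X') ++ (D , suc n) ∷ rowsOf (b ∷ X''))
  before = subst (ValidRows _ T) (rowsOf-cornerD p X' X'') (isCMCT⇒validRows t)
  after : ValidRows (colKinds (X' ++ D ∷ b ∷ X'')) (moveRow n h T)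
                    (lengthenRows (suc n) (rowsOf X') ++ insertRowBelow n (D , n) (rowsOf (b ∷ X'')))
  after = moveRow-valid (D∉colKinds (X' ++ D ∷ b ∷ X'')) (rowsOf-descending (b ∷ X''))
            (lengthenRows-≥ (suc n) (rowsOf X')) before (subst (λ m → cellAt T m n ≡ just β) h≡ eβ)
  transition≡ : transitionβ T (southCount X') ≡ moveRow n h T
  transition≡ = begin
    transitionβ T (southCount X')    ≡⟨ cong (transitionβ T) h≡ ⟩
    moveRow (rowLength T h ∸ 1) h T  ≡⟨ cong (λ l → moveRow (l ∸ 1) h T) (cornerRow-length before) ⟩
    moveRow n h T                    ∎

lemma4p3 : (X' X'' : Word) (a b : Letter) → CornerPair a b →
    (T : Filling) → IsCMCT (X' ++ a ∷ b ∷ X'') T →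
    cellAt T (southCount X') (westCount X'') ≡ just β →
    IsCMCT (X' ++ b ∷ a ∷ X'') (transitionβ T (southCount X'))
lemma4p3 X' X'' D E DE _ = transitionβ-cornerD X' X'' DE
lemma4p3 X' X'' D A DA _ = transitionβ-cornerD X' X'' DA
lemma4p3 X' X'' A E AE T t eβ = ⊥-elim (β∉A-row t (rowKinds-southCount X' (E ∷ X'')) w<west eβ)
  where
  w<west : westCount X'' < westCount (X' ++ A ∷ E ∷ X'')
  w<west = subst (westCount X'' <_) (sym (westCount-++ X' (A ∷ E ∷ X'')))
                 (≤-trans (n≤1+n _) (m≤n+m _ (westCount X')))
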